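{- For any tree $T$ with at least three vertices, $\kappa(T)\ge 2$.
   Context: $d_T$ is the shortest-path distance. For $S\subseteq V(T)$ and $x\in V(T)$, $m(x|S)$ is the multiset $\{\!\{d_T(x,s): s\in S\}\!\}$. A nonempty set $S\subsetneq V(T)$ is a $k$-multiset antiresolving set ($k$-MARS) if $k$ equals the minimum size of an equivalence class of the relation on $V(T)\setminus S$ given by $x\sim y \iff m(x|S)=m(y|S)$. $\kappa(T)$ denotes the largest integer $k$ such that $T$ contains a $k$-MARS. -}

module Defs where

open import Data.Nat using (ℕ; zero; suc; _+_; _≤_; _≡ᵇ_)
open import Data.Bool using (Bool; true; false; if_then_else_; _∧_; _∨_; not)
open import Data.Fin using (Fin; zero; suc; inject₁; fromℕ)
open import Data.Product using (Σ; ∃; _×_; _,_)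
open import Relation.Binary.PropositionalEquality using (_≡_)
open import Relation.Nullary using (¬_)
open import Function.Definitions using (Injective)

Graph : ℕ → Set
Graph n = Fin n → Fin n → Bool

anyF : ∀ {n} → (Fin n → Bool) → Bool
anyF {zero}  p = false
anyF {suc n} p = p zero ∨ anyF (λ i → p (suc i))

countF : ∀ {n} → (Fin n → Bool) → ℕ
countF {zero}  p = 0
countF {suc n} p = (if p zero then 1 else 0) + countF (λ i → p (suc i))

_==_ : ∀ {n} → Fin n → Fin n → Bool
zero  == zero  = true
zero  == suc _ = false
suc _ == zero  = false
suc i == suc j = i == j

walk : ∀ {n} → Graph n → ℕ → Fin n → Fin n → Bool
walk G zero    x y = x == y
walk G (suc k) x y = anyF (λ z → G x z ∧ walk G k z y)

IsSimple : ∀ {n} → Graph n → Set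
IsSimple {n} G = (∀ x y → G x y ≡ G y x) × (∀ x → G x x ≡ false)

Connected : ∀ {n} → Graph n → Set
Connected {n} G = ∀ (x y : Fin n) → ∃ λ k → walk G k x y ≡ true

HasCycle : ∀ {n} → Graph n → Set
HasCycle {n} G =
  Σ ℕ λ m → Σ (Fin (suc (suc (suc m))) → Fin n) λ v →
    Injective _≡_ _≡_ v
    × (∀ (i : Fin (suc (suc m))) → G (v (inject₁ i)) (v (suc i)) ≡ true)
    × (G (v (fromℕ (suc (suc m)))) (v zero) ≡ true)

IsTree : ∀ {n} → Graph n → Set
IsTree G = IsSimple G × Connected G × ¬ HasCycle G

-- Shortest-path distance: the least k ≤ n admitting a walk of length k
-- (for a connected graph on n vertices this is d_T(x,y), which is < n).
distFrom : ∀ {n} → Graph n → Fin n → Fin n → ℕ → ℕ → ℕ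
distFrom G x y i zero     = i
distFrom G x y i (suc f) = if walk G i x y then i else distFrom G x y (suc i) f

dist : ∀ {n} → Graph n → Fin n → Fin n → ℕ
dist {n} G x y = distFrom G x y 0 n

VSet : ℕ → Set
VSet n = Fin n → Bool

-- Multiplicity of the value r in the multiset m(x|S) = {{ d(x,s) : s ∈ S }}.
mult : ∀ {n} → Graph n → VSet n → Fin n → ℕ → ℕ
mult G S x r = countF (λ s → S s ∧ (dist G x s ≡ᵇ r))

-- Multiset equality m(x|S) = m(y|S): equal multiplicities of every value
-- r ≤ n (all distance values produced by dist are ≤ n, so this is full
-- multiset equality).
allUpTo : ℕ → (ℕ → Bool) → Bool
allUpTo zero    p = p zero
allUpTo (suc r) p = p (suc r) ∧ allUpTo r p

sameM : ∀ {n} → Graph n → VSet n → Fin n → Fin n → Bool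
sameM {n} G S x y = allUpTo n (λ r → mult G S x r ≡ᵇ mult G S y r)

classSize : ∀ {n} → Graph n → VSet n → Fin n → ℕ
classSize G S x = countF (λ y → not (S y) ∧ sameM G S x y)

IsMARS : ∀ {n} → Graph n → VSet n → ℕ → Set
IsMARS {n} G S k =
  (∃ λ (s : Fin n) → S s ≡ true)
  × (∃ λ (x : Fin n) → S x ≡ false)
  × (∃ λ (x : Fin n) → S x ≡ false × classSize G S x ≡ k)
  × (∀ (x : Fin n) → S x ≡ false → k ≤ classSize G S x)

-- κ(T) ≥ k₀  iff  T has a k-MARS for some k ≥ k₀ (κ(T) being the largest such k).
KappaAtLeast : ∀ {n} → Graph n → ℕ → Set
KappaAtLeast {n} G k₀ = Σ ℕ λ k → Σ (VSet n) λ S → k₀ ≤ k × IsMARS G S k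

{-# OPTIONS --safe #-}
module Submission where

-- Let c be a vertex of minimum eccentricity r, and call dist c x the depth of x. No depth strictly
-- between 0 and r is attained by a single vertex w: otherwise the neighbour of c towards w would have
-- eccentricity below r. If depth r is attained twice, S = {c} works, its classes being the
-- depth levels. Otherwise some b is the only vertex at depth r; let c′ be the neighbour of c towards b
-- and S = {c, c′}. In a tree the two ends of an edge are at distances differing by exactly one from
-- any x, so m(x | S) = {i, i + 1} for some 1 ≤ i < r. Each such class contains a vertex at depth i on
-- a shortest walk from c to a vertex farthest from c′, and one at depth i + 1 on a shortest walk from
-- c′ to b. In both cases every class has at least two elements, hence so does the smallest one.

open import Defs
open import Data.Nat using (ℕ; zero; suc; _+_; _∸_; _≤_; _<_; _≤?_; _<?_; _≟_; _≡ᵇ_; z≤n; s≤s)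
open import Data.Nat.Properties
open import Data.Bool using (Bool; true; false; if_then_else_; _∧_; _∨_; not)
import Data.Bool.Properties as Bool
open import Data.Fin using (Fin; zero; suc; toℕ; inject₁; fromℕ; fromℕ<; punchIn; punchOut)
import Data.Fin.Properties as Fin
open import Data.Product using (∃; _×_; _,_; proj₁; proj₂)
open import Data.Sum using (_⊎_; inj₁; inj₂; [_,_]′)
open import Data.Empty using (⊥; ⊥-elim)
open import Relation.Binary.PropositionalEquality hiding ([_])
open import Relation.Nullary using (¬_; ¬?; yes; no)
open import Relation.Nullary.Decidable using (_×-dec_; decidable-stable)
open import Relation.Unary using (Decidable)
open import Relation.Binary.Definitions using (tri<; tri≈; tri>)
open import Function using (_∘_; _∘′_; case_of_)
open import Data.Nat.Induction using (<-rec)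
open import Data.List using (allFin; filter)
import Data.List.Relation.Unary.All as All
open import Data.List.Relation.Unary.All.Properties using (all-filter)
open import Data.List.Membership.Propositional.Properties using (∈-allFin; ∈-filter⁺)
open import Data.List.Extrema.Nat using (argmin; argmax; argmin-all; f[argmin]≤f[xs]; f[xs]≤f[argmax])
open import Function.Bundles using (Equivalence)

∧-true⁻ : ∀ {a b} → a ∧ b ≡ true → a ≡ true × b ≡ true
∧-true⁻ {true} {true} _ = refl , refl

∧-true⁺ : ∀ {a b} → a ≡ true → b ≡ true → a ∧ b ≡ true
∧-true⁺ refl refl = refl

∨-false⁻ : ∀ {a b} → a ∨ b ≡ false → a ≡ false × b ≡ false
∨-false⁻ {false} {false} _ = refl , refl

==⇒≡ : ∀ {n} {x y : Fin n} → (x == y) ≡ true → x ≡ y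
==⇒≡ {x = zero}  {zero}  _ = refl
==⇒≡ {x = suc x} {suc y} e = cong suc (==⇒≡ e)

==-refl : ∀ {n} (x : Fin n) → (x == x) ≡ true
==-refl zero    = refl
==-refl (suc x) = ==-refl x

≢⇒==-false : ∀ {n} {x y : Fin n} → x ≢ y → (x == y) ≡ false
≢⇒==-false {x = x} {y} x≢y with x == y in e
... | true  = ⊥-elim (x≢y (==⇒≡ e))
... | false = refl

==-false⇒≢ : ∀ {n} {x y : Fin n} → (x == y) ≡ false → x ≢ y
==-false⇒≢ {x = x} e refl with () ← trans (sym e) (==-refl x)

anyF⇒∃ : ∀ {n} (p : Fin n → Bool) → anyF p ≡ true → ∃ λ i → p i ≡ true
anyF⇒∃ {suc n} p e with p zero in p₀
... | true  = zero , p₀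
... | false with i , pᵢ ← anyF⇒∃ (λ i → p (suc i)) e = suc i , pᵢ

∃⇒anyF : ∀ {n} (p : Fin n → Bool) i → p i ≡ true → anyF p ≡ true
∃⇒anyF p zero    pᵢ rewrite pᵢ = refl
∃⇒anyF p (suc i) pᵢ with p zero
... | true  = refl
... | false = ∃⇒anyF (λ j → p (suc j)) i pᵢ

indicator : Bool → ℕ
indicator b = if b then 1 else 0

countF-cong : ∀ {n} {p q : Fin n → Bool} → (∀ i → p i ≡ q i) → countF p ≡ countF q
countF-cong {zero}  p≗q = refl
countF-cong {suc n} p≗q = cong₂ _+_ (cong indicator (p≗q zero)) (countF-cong (λ i → p≗q (suc i)))

countF-false : ∀ {n} (p : Fin n → Bool) → (∀ i → p i ≡ false) → countF p ≡ 0
countF-false {zero}  p p≗false = refl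
countF-false {suc n} p p≗false rewrite p≗false zero = countF-false (λ i → p (suc i)) (λ i → p≗false (suc i))

countF-∨ : ∀ {n} (p q : Fin n → Bool) → (∀ i → p i ∧ q i ≡ false) →
           countF (λ i → p i ∨ q i) ≡ countF p + countF q
countF-∨ {zero}  p q disjoint = refl
countF-∨ {suc n} p q disjoint
  with p zero | q zero | disjoint zero | countF-∨ (λ i → p (suc i)) (λ i → q (suc i)) (λ i → disjoint (suc i))
... | true  | false | _ | ih = cong suc ih
... | false | true  | _ | ih = trans (cong suc ih) (sym (+-suc _ _))
... | false | false | _ | ih = ih

countF-==∧ : ∀ {n} (c : Fin n) (p : Fin n → Bool) → countF (λ s → (s == c) ∧ p s) ≡ indicator (p c)
countF-==∧ zero p =
  trans (cong (indicator (p zero) +_) (countF-false (λ i → (suc i == zero) ∧ p (suc i)) (λ _ → refl)))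
        (+-identityʳ _)
countF-==∧ (suc c) p = countF-==∧ c (λ i → p (suc i))

countF-≥1 : ∀ {n} (p : Fin n → Bool) i → p i ≡ true → 1 ≤ countF p
countF-≥1 p zero    pᵢ rewrite pᵢ = s≤s z≤n
countF-≥1 p (suc i) pᵢ = ≤-trans (countF-≥1 (λ j → p (suc j)) i pᵢ) (m≤n+m _ _)

countF-≥2 : ∀ {n} (p : Fin n → Bool) i j → i ≢ j → p i ≡ true → p j ≡ true → 2 ≤ countF p
countF-≥2 p zero    zero    i≢j _  _  = ⊥-elim (i≢j refl)
countF-≥2 p zero    (suc j) _   pᵢ pⱼ rewrite pᵢ = s≤s (countF-≥1 (λ k → p (suc k)) j pⱼ)
countF-≥2 p (suc i) zero    _   pᵢ pⱼ rewrite pⱼ = s≤s (countF-≥1 (λ k → p (suc k)) i pᵢ)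
countF-≥2 p (suc i) (suc j) i≢j pᵢ pⱼ =
  ≤-trans (countF-≥2 (λ k → p (suc k)) i j (i≢j ∘′ cong suc) pᵢ pⱼ) (m≤n+m _ _)

least-witness : ∀ {p} {P : ℕ → Set p} → Decidable P → ∀ {k} → P k →
                ∃ λ j → j ≤ k × P j × (∀ {i} → i < j → ¬ P i)
least-witness P? {k} pₖ with P? 0
... | yes p₀ = 0 , z≤n , p₀ , λ ()
least-witness P? {zero}  pₖ | no ¬p₀ = ⊥-elim (¬p₀ pₖ)
least-witness P? {suc k} pₖ | no ¬p₀ with j , j≤k , pⱼ , before ← least-witness (P? ∘ suc) pₖ =
  suc j , s≤s j≤k , pⱼ , λ { {zero} _ → ¬p₀ ; {suc i} (s≤s i<j) → before i<j }

minimiser : ∀ {n p} {P : Fin n → Set p} → Decidable P → (f : Fin n → ℕ) → ∀ {x₀} → P x₀ →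
            ∃ λ m → P m × (∀ y → P y → f m ≤ f y)
minimiser {n} P? f {x₀} Px₀ =
  argmin f x₀ candidates ,
  argmin-all f Px₀ (all-filter P? (allFin n)) ,
  λ y Py → All.lookup (f[argmin]≤f[xs] x₀ candidates) (∈-filter⁺ P? (∈-allFin y) Py)
  where
    candidates = filter P? (allFin n)

-- punchIn c enumerates the vertices other than c; inside that enumeration, skip c′ as well.
fresh : ∀ {n} → 3 ≤ n → (c c′ : Fin n) → ∃ λ z → z ≢ c × z ≢ c′
fresh (s≤s (s≤s (s≤s _))) c c′ with c Fin.≟ c′
... | yes refl = punchIn c zero , Fin.punchInᵢ≢i c zero , Fin.punchInᵢ≢i c zero
... | no  c≢c′ = punchIn c (punchIn i zero) , Fin.punchInᵢ≢i c _ , z≢c′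
  where
    i = punchOut c≢c′
    z≢c′ : punchIn c (punchIn i zero) ≢ c′
    z≢c′ z≡c′ = Fin.punchInᵢ≢i i zero
      (Fin.punchIn-injective c _ _ (trans z≡c′ (sym (Fin.punchIn-punchOut c≢c′))))

unique-or-another : ∀ {n p} {P : Fin n → Set p} → Decidable P → ∀ w →
                    (∀ y → P y → y ≡ w) ⊎ (∃ λ y → P y × y ≢ w)
unique-or-another P? w with Fin.any? (λ y → P? y ×-dec ¬? (y Fin.≟ w))
... | yes another = inj₂ another
... | no  ∄       = inj₁ λ y Py → decidable-stable (y Fin.≟ w) (λ y≢w → ∄ (y , Py , y≢w))

module Walks {n} (G : Graph n) where

  infixr 5 _∷_ _++_

  data Walk : ℕ → Fin n → Fin n → Set where
    []  : ∀ {x} → Walk 0 x x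
    _∷_ : ∀ {k x y z} → G x y ≡ true → Walk k y z → Walk (suc k) x z

  walk⇒Walk : ∀ k {x y} → walk G k x y ≡ true → Walk k x y
  walk⇒Walk zero    e = subst (Walk 0 _) (==⇒≡ e) []
  walk⇒Walk (suc k) {x} {y} e
    with z , e′ ← anyF⇒∃ (λ z → G x z ∧ walk G k z y) e
    with xz , zy ← ∧-true⁻ {G x z} e′ = xz ∷ walk⇒Walk k zy

  Walk⇒walk : ∀ {k x y} → Walk k x y → walk G k x y ≡ true
  Walk⇒walk {x = x} [] = ==-refl x
  Walk⇒walk {suc k} {x} {y} (_∷_ {y = z} xz w) =
    ∃⇒anyF (λ z → G x z ∧ walk G k z y) z (∧-true⁺ xz (Walk⇒walk w))

  _++_ : ∀ {i j x y z} → Walk i x y → Walk j y z → Walk (i + j) x z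
  []       ++ v = v
  (e ∷ w) ++ v = e ∷ (w ++ v)

  _∷ʳ_ : ∀ {k x y z} → Walk k x y → G y z ≡ true → Walk (suc k) x z
  []       ∷ʳ e′ = e′ ∷ []
  (e ∷ w) ∷ʳ e′ = e ∷ (w ∷ʳ e′)

  reverse : (∀ x y → G x y ≡ G y x) → ∀ {k x y} → Walk k x y → Walk k y x
  reverse G-sym []                   = []
  reverse G-sym (_∷_ {x = x} {y} e w) = reverse G-sym w ∷ʳ trans (G-sym y x) e

  _[_] : ∀ {k x y} → Walk k x y → ℕ → Fin n
  _[_] {x = x} []      i       = x
  _[_] {x = x} (e ∷ w) zero    = x
  _[_]         (e ∷ w) (suc i) = w [ i ]

  [0] : ∀ {k x y} (w : Walk k x y) → w [ 0 ] ≡ x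
  [0] []      = refl
  [0] (e ∷ w) = refl

  [end] : ∀ {k x y} (w : Walk k x y) → w [ k ] ≡ y
  [end] []      = refl
  [end] (e ∷ w) = [end] w

  [i]-edge : ∀ {k x y} (w : Walk k x y) i → i < k → G (w [ i ]) (w [ suc i ]) ≡ true
  [i]-edge (_∷_ {x = x} e w) zero    _         = subst (λ v → G x v ≡ true) (sym ([0] w)) e
  [i]-edge (e ∷ w)           (suc i) (s≤s i<k) = [i]-edge w i i<k

  take : ∀ {k x y} (w : Walk k x y) i → i ≤ k → Walk i x (w [ i ])
  take []      zero    _         = []
  take (e ∷ w) zero    _         = []
  take (e ∷ w) (suc i) (s≤s i≤k) = e ∷ take w i i≤k

  drop : ∀ {k x y} (w : Walk k x y) i → i ≤ k → Walk (k ∸ i) (w [ i ]) y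
  drop []      zero    _         = []
  drop (e ∷ w) zero    _         = e ∷ w
  drop (e ∷ w) (suc i) (s≤s i≤k) = drop w i i≤k

  Walk0⇒≡ : ∀ {x y} → Walk 0 x y → x ≡ y
  Walk0⇒≡ [] = refl

  -- Pigeonhole: a walk of length ≥ n repeats a vertex, and the loop between the repeats can be cut out.
  shortcut : ∀ {k x y} → Walk k x y → n ≤ k → ∃ λ j → j < k × Walk j x y
  shortcut {k} {x} {y} w n≤k
    with i , j , i<j , wᵢ≡wⱼ ← Fin.pigeonhole (s≤s n≤k) (λ t → w [ toℕ t ]) =
    toℕ i + (k ∸ toℕ j) , shorter ,
    take w (toℕ i) i≤k ++ subst (λ v → Walk (k ∸ toℕ j) v y) (sym wᵢ≡wⱼ) (drop w (toℕ j) j≤k)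
    where
      j≤k : toℕ j ≤ k
      j≤k = ≤-pred (Fin.toℕ<n j)
      i≤k : toℕ i ≤ k
      i≤k = ≤-trans (<⇒≤ i<j) j≤k
      shorter : toℕ i + (k ∸ toℕ j) < k
      shorter = begin-strict
        toℕ i + (k ∸ toℕ j) <⟨ +-monoˡ-< (k ∸ toℕ j) i<j ⟩
        toℕ j + (k ∸ toℕ j) ≡⟨ m+[n∸m]≡n j≤k ⟩
        k                   ∎
        where open ≤-Reasoning

  shorten : ∀ k {x y} → Walk k x y → ∃ λ j → j < n × Walk j x y
  shorten = <-rec (λ k → ∀ {x y} → Walk k x y → ∃ λ j → j < n × Walk j x y) step
    where
      step : ∀ k → (∀ {j} → j < k → ∀ {x y} → Walk j x y → ∃ λ i → i < n × Walk i x y) →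
             ∀ {x y} → Walk k x y → ∃ λ j → j < n × Walk j x y
      step k rec w with k <? n
      ... | yes k<n = k , k<n , w
      ... | no  k≮n with j , j<k , w′ ← shortcut w (≮⇒≥ k≮n) = rec j<k w′

module Distance {n} (G : Graph n) (G-sym : ∀ x y → G x y ≡ G y x) (connected : Connected G) where
  open Walks G public

  distFrom-minimal : ∀ {k x y} → walk G k x y ≡ true → ∀ i f → i ≤ k → distFrom G x y i f ≤ k
  distFrom-minimal e i zero    i≤k = i≤k
  distFrom-minimal {k} {x} {y} e i (suc f) i≤k with walk G i x y in eᵢ
  ... | true  = i≤k
  ... | false = distFrom-minimal e (suc i) f (≤∧≢⇒< i≤k λ { refl → case trans (sym eᵢ) e of λ () })

  distFrom-attained : ∀ {k x y} → walk G k x y ≡ true → ∀ i f → i ≤ k → k < i + f →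
                      walk G (distFrom G x y i f) x y ≡ true
  distFrom-attained e i zero    i≤k k<i+0 = ⊥-elim (<⇒≱ k<i+0 (≤-trans (≤-reflexive (+-identityʳ i)) i≤k))
  distFrom-attained {k} {x} {y} e i (suc f) i≤k k<i+f with walk G i x y in eᵢ
  ... | true  = eᵢ
  ... | false = distFrom-attained e (suc i) f (≤∧≢⇒< i≤k λ { refl → case trans (sym eᵢ) e of λ () })
                  (subst (k <_) (+-suc i f) k<i+f)

  dist-minimal : ∀ {k x y} → Walk k x y → dist G x y ≤ k
  dist-minimal w = distFrom-minimal (Walk⇒walk w) 0 n z≤n

  -- Connectivity gives some walk, and shortening it below n makes the search in dist succeed.
  geodesic : ∀ x y → Walk (dist G x y) x y
  geodesic x y
    with k , e ← connected x y
    with j , j<n , w ← shorten k (walk⇒Walk k e) =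
    walk⇒Walk _ (distFrom-attained (Walk⇒walk w) 0 n z≤n j<n)

  dist-sym : ∀ x y → dist G x y ≡ dist G y x
  dist-sym x y = ≤-antisym (dist-minimal (reverse G-sym (geodesic y x)))
                           (dist-minimal (reverse G-sym (geodesic x y)))

  dist-triangle : ∀ x y z → dist G x z ≤ dist G x y + dist G y z
  dist-triangle x y z = dist-minimal (geodesic x y ++ geodesic y z)

  dist-refl : ∀ x → dist G x x ≡ 0
  dist-refl x = n≤0⇒n≡0 (dist-minimal {x = x} [])

  dist≡0⇒≡ : ∀ {x y} → dist G x y ≡ 0 → x ≡ y
  dist≡0⇒≡ {x} {y} e = Walk0⇒≡ (subst (λ k → Walk k x y) e (geodesic x y))

  ≢⇒0<dist : ∀ {x y} → y ≢ x → 0 < dist G x y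
  ≢⇒0<dist {x} {y} y≢x with dist G x y in e
  ... | zero  = ⊥-elim (y≢x (sym (dist≡0⇒≡ e)))
  ... | suc _ = s≤s z≤n

  0<dist⇒≢ : ∀ {x y} → 0 < dist G x y → y ≢ x
  0<dist⇒≢ {x} 0<d refl = <⇒≱ 0<d (≤-reflexive (dist-refl x))

  edge-sym : ∀ {x y} → G x y ≡ true → G y x ≡ true
  edge-sym {x} {y} e = trans (G-sym y x) e

  geodesic-dist : ∀ {k x y} (w : Walk k x y) → dist G x y ≡ k → ∀ i → i ≤ k →
                 dist G x (w [ i ]) ≡ i × dist G (w [ i ]) y ≡ k ∸ i
  geodesic-dist {k} {x} {y} w dₓᵧ≡k i i≤k =
    squeeze (dist-minimal (take w i i≤k)) (dist-minimal (drop w i i≤k))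
      (begin
        i + (k ∸ i)                          ≡⟨ m+[n∸m]≡n i≤k ⟩
        k                                    ≡⟨ dₓᵧ≡k ⟨
        dist G x y                           ≤⟨ dist-triangle x (w [ i ]) y ⟩
        dist G x (w [ i ]) + dist G (w [ i ]) y ∎)
    where
      open ≤-Reasoning
      squeeze : ∀ {a b i j} → a ≤ i → b ≤ j → i + j ≤ a + b → a ≡ i × b ≡ j
      squeeze {a} {b} {i} {j} a≤i b≤j i+j≤a+b =
        ≤-antisym a≤i (+-cancelʳ-≤ j i a (≤-trans i+j≤a+b (+-monoʳ-≤ a b≤j))) ,
        ≤-antisym b≤j (+-cancelˡ-≤ i j b (≤-trans i+j≤a+b (+-monoˡ-≤ b a≤i)))

  -- Vertices of two shortest walks into y are told apart by their distance to y.
  geodesics-[]-injective : ∀ {k a b y} (A : Walk k a y) (B : Walk k b y) → dist G a y ≡ k → dist G b y ≡ k →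
                           ∀ {s t} → s ≤ k → t ≤ k → A [ s ] ≡ B [ t ] → s ≡ t
  geodesics-[]-injective {y = y} A B dA dB {s} {t} s≤k t≤k Aₛ≡Bₜ =
    ∸-cancelˡ-≡ s≤k t≤k (begin
      _ ∸ s                ≡⟨ proj₂ (geodesic-dist A dA s s≤k) ⟨
      dist G (A [ s ]) y   ≡⟨ cong (λ z → dist G z y) Aₛ≡Bₜ ⟩
      dist G (B [ t ]) y   ≡⟨ proj₂ (geodesic-dist B dB t t≤k) ⟩
      _ ∸ t                ∎)
    where open ≡-Reasoning

  edge⇒dist≤1+dist : ∀ {u v} → G u v ≡ true → ∀ x → dist G v x ≤ suc (dist G u x)
  edge⇒dist≤1+dist uv x = dist-minimal (edge-sym uv ∷ geodesic _ x)

  first-step : ∀ {u w} → 0 < dist G u w → ∃ λ u′ → G u u′ ≡ true × suc (dist G u′ w) ≡ dist G u w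
  first-step {u} {w} 0<d =
    P [ 1 ] ,
    subst (λ z → G z (P [ 1 ]) ≡ true) ([0] P) ([i]-edge P 0 0<d) ,
    trans (cong suc (proj₂ (geodesic-dist P refl 1 0<d))) (m+[n∸m]≡n 0<d)
    where P = geodesic u w

  geodesic-away : ∀ {u v z} → G u v ≡ true → dist G v z ≡ suc (dist G u z) → ∀ {i} → i ≤ dist G u z →
                  dist G u (geodesic u z [ i ]) ≡ i × dist G v (geodesic u z [ i ]) ≡ suc i
  geodesic-away {u} {v} {z} uv away {i} i≤k = uₚ≡i , ≤-antisym upper lower
    where
      k = dist G u z
      p = geodesic u z [ i ]
      uₚ≡i : dist G u p ≡ i
      uₚ≡i = proj₁ (geodesic-dist (geodesic u z) refl i i≤k)
      upper : dist G v p ≤ suc i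
      upper = subst (λ d → dist G v p ≤ suc d) uₚ≡i (edge⇒dist≤1+dist uv p)
      lower : suc i ≤ dist G v p
      lower = +-cancelʳ-≤ (k ∸ i) (suc i) (dist G v p) (begin
        suc i + (k ∸ i)          ≡⟨ cong suc (m+[n∸m]≡n i≤k) ⟩
        suc k                    ≡⟨ away ⟨
        dist G v z               ≤⟨ dist-triangle v p z ⟩
        dist G v p + dist G p z  ≡⟨ cong (dist G v p +_) (proj₂ (geodesic-dist (geodesic u z) refl i i≤k)) ⟩
        dist G v p + (k ∸ i)     ∎)
        where open ≤-Reasoning

module Tree {n} (G : Graph n) (G-sym : ∀ x y → G x y ≡ G y x) (G-irrefl : ∀ x → G x x ≡ false)
            (connected : Connected G) (acyclic : ¬ HasCycle G) where
  open Distance G G-sym connected public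

  edge⇒≢ : ∀ {x y} → G x y ≡ true → x ≢ y
  edge⇒≢ {x} e refl with () ← trans (sym e) (G-irrefl x)

  -- Equal distances from the ends u, v of an edge to x close an odd cycle through the first common
  -- vertex of shortest walks P from u and Q from v to x.
  module OddCycle {u v x} (uv : G u v ≡ true) (same : dist G u x ≡ dist G v x) where
    k : ℕ
    k = dist G u x

    P : Walk k u x
    P = geodesic u x

    Q : Walk k v x
    Q = subst (λ m → Walk m v x) (sym same) (geodesic v x)

    P-Q-injective : ∀ {s t} → s ≤ k → t ≤ k → P [ s ] ≡ Q [ t ] → s ≡ t
    P-Q-injective = geodesics-[]-injective P Q refl (sym same)

    Meet : ℕ → Set
    Meet t = P [ t ] ≡ Q [ t ]

    module Ring (j′ : ℕ) (j≤k : suc j′ ≤ k)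
                (meet : Meet (suc j′)) (before : ∀ {i} → i < suc j′ → ¬ Meet i) where
      j m : ℕ
      j = suc j′
      m = j′ + j′

      -- The cycle u = P [ 0 ], …, P [ j ] = Q [ j ], …, Q [ 0 ] = v, indexed by 0, …, j + j.
      ring : ℕ → Fin n
      ring t with t ≤? j
      ... | yes _ = P [ t ]
      ... | no  _ = Q [ j + j ∸ t ]

      ring-P : ∀ {t} → t ≤ j → ring t ≡ P [ t ]
      ring-P {t} t≤j with t ≤? j
      ... | yes _   = refl
      ... | no  t≰j = ⊥-elim (t≰j t≤j)

      ring-Q : ∀ {t} → j ≤ t → ring t ≡ Q [ j + j ∸ t ]
      ring-Q {t} j≤t with t ≤? j
      ... | no  _   = refl
      ... | yes t≤j with refl ← ≤-antisym j≤t t≤j = trans meet (cong (Q [_]) (sym (m+n∸m≡n j j)))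

      mirror≤ : ∀ {t} → j ≤ t → j + j ∸ t ≤ j
      mirror≤ {t} j≤t = subst (j + j ∸ t ≤_) (m+n∸m≡n j j) (∸-monoʳ-≤ (j + j) j≤t)

      mirror< : ∀ {t} → j < t → t ≤ j + j → j + j ∸ t < j
      mirror< {t} j<t t≤2j = subst (j + j ∸ t <_) (m+n∸m≡n j j) (∸-monoʳ-< j<t t≤2j)

      no-chord : ∀ {s t} → s ≤ j → j < t → t ≤ j + j → ring s ≢ ring t
      no-chord {s} {t} s≤j j<t t≤2j ringₛ≡ringₜ =
        before (mirror< j<t t≤2j) (subst (λ i → P [ i ] ≡ Q [ j + j ∸ t ]) s≡l Pₛ≡Qₗ)
        where
          Pₛ≡Qₗ : P [ s ] ≡ Q [ j + j ∸ t ]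
          Pₛ≡Qₗ = trans (sym (ring-P s≤j)) (trans ringₛ≡ringₜ (ring-Q (<⇒≤ j<t)))
          s≡l : s ≡ j + j ∸ t
          s≡l = P-Q-injective (≤-trans s≤j j≤k) (≤-trans (<⇒≤ (mirror< j<t t≤2j)) j≤k) Pₛ≡Qₗ

      ring-injective : ∀ {s t} → s ≤ j + j → t ≤ j + j → ring s ≡ ring t → s ≡ t
      ring-injective {s} {t} s≤2j t≤2j ringₛ≡ringₜ with ≤-<-connex s j | ≤-<-connex t j
      ... | inj₁ s≤j | inj₁ t≤j =
        geodesics-[]-injective P P refl refl (≤-trans s≤j j≤k) (≤-trans t≤j j≤k)
          (trans (sym (ring-P s≤j)) (trans ringₛ≡ringₜ (ring-P t≤j)))
      ... | inj₂ j<s | inj₂ j<t =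
        ∸-cancelˡ-≡ s≤2j t≤2j
          (geodesics-[]-injective Q Q (sym same) (sym same) (lower j<s s≤2j) (lower j<t t≤2j)
            (trans (sym (ring-Q (<⇒≤ j<s))) (trans ringₛ≡ringₜ (ring-Q (<⇒≤ j<t)))))
        where
          lower : ∀ {t} → j < t → t ≤ j + j → j + j ∸ t ≤ k
          lower j<t t≤2j = ≤-trans (<⇒≤ (mirror< j<t t≤2j)) j≤k
      ... | inj₁ s≤j | inj₂ j<t = ⊥-elim (no-chord s≤j j<t t≤2j ringₛ≡ringₜ)
      ... | inj₂ j<s | inj₁ t≤j = ⊥-elim (no-chord t≤j j<s s≤2j (sym ringₛ≡ringₜ))

      ring-edge : ∀ {t} → t < j + j → G (ring t) (ring (suc t)) ≡ true
      ring-edge {t} t<2j with ≤-<-connex (suc t) j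
      ... | inj₁ t<j =
        subst₂ (λ a b → G a b ≡ true) (sym (ring-P (<⇒≤ t<j))) (sym (ring-P t<j)) ([i]-edge P t (≤-trans t<j j≤k))
      ... | inj₂ j<1+t =
        subst₂ (λ a b → G a b ≡ true) (sym (trans (ring-Q j≤t) (cong (Q [_]) l+1))) (sym (ring-Q (m≤n⇒m≤1+n j≤t)))
          (edge-sym ([i]-edge Q (j + j ∸ suc t) l<k))
        where
          j≤t : j ≤ t
          j≤t = ≤-pred j<1+t
          l+1 : j + j ∸ t ≡ suc (j + j ∸ suc t)
          l+1 = +-∸-assoc 1 t<2j
          l<k : j + j ∸ suc t < k
          l<k = ≤-trans (subst (_≤ j) l+1 (mirror≤ j≤t)) j≤k

      2j≡2+m : j + j ≡ suc (suc m)
      2j≡2+m = cong suc (+-suc j′ j′)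

      ring-closing : G (ring (suc (suc m))) (ring 0) ≡ true
      ring-closing = subst₂ (λ a b → G a b ≡ true) (sym ring₂ⱼ≡v) (sym ring₀≡u) (edge-sym uv)
        where
          ring₂ⱼ≡v : ring (suc (suc m)) ≡ v
          ring₂ⱼ≡v = begin
            ring (suc (suc m))          ≡⟨ cong ring 2j≡2+m ⟨
            ring (j + j)                ≡⟨ ring-Q (m≤n+m j j) ⟩
            Q [ j + j ∸ (j + j) ]       ≡⟨ cong (Q [_]) (n∸n≡0 (j + j)) ⟩
            Q [ 0 ]                     ≡⟨ [0] Q ⟩
            v                           ∎
            where open ≡-Reasoning
          ring₀≡u : ring 0 ≡ u
          ring₀≡u = trans (ring-P z≤n) ([0] P)

      cycle : HasCycle G
      cycle = m , ring ∘ toℕ , injective , edges , closing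
        where
          bounded : (i : Fin (suc (suc (suc m)))) → toℕ i ≤ j + j
          bounded i = subst (toℕ i ≤_) (sym 2j≡2+m) (≤-pred (Fin.toℕ<n i))
          injective : ∀ {s t} → ring (toℕ s) ≡ ring (toℕ t) → s ≡ t
          injective {s} {t} e = Fin.toℕ-injective (ring-injective (bounded s) (bounded t) e)
          edges : (i : Fin (suc (suc m))) → G (ring (toℕ (inject₁ i))) (ring (suc (toℕ i))) ≡ true
          edges i rewrite Fin.toℕ-inject₁ i = ring-edge (subst (toℕ i <_) (sym 2j≡2+m) (Fin.toℕ<n i))
          closing : G (ring (toℕ (fromℕ (suc (suc m))))) (ring 0) ≡ true
          closing = subst (λ t → G (ring t) (ring 0) ≡ true) (sym (Fin.toℕ-fromℕ (suc (suc m)))) ring-closing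

    cycle : HasCycle G
    cycle with least-witness (λ t → P [ t ] Fin.≟ Q [ t ]) (trans ([end] P) (sym ([end] Q)))
    ... | zero    , _   , meet₀ , _      = ⊥-elim (edge⇒≢ uv (trans (sym ([0] P)) (trans meet₀ ([0] Q))))
    ... | suc j′ , j≤k , meet  , before = Ring.cycle j′ j≤k meet before

  edge⇒dist≢ : ∀ {u v} x → G u v ≡ true → dist G u x ≢ dist G v x
  edge⇒dist≢ x uv same = acyclic (OddCycle.cycle uv same)

  edge⇒dist-step : ∀ {u v} x → G u v ≡ true → dist G v x ≡ suc (dist G u x) ⊎ dist G u x ≡ suc (dist G v x)
  edge⇒dist-step {u} {v} x uv with <-cmp (dist G u x) (dist G v x)
  ... | tri< uₓ<vₓ _ _ = inj₁ (≤-antisym (edge⇒dist≤1+dist uv x) uₓ<vₓ)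
  ... | tri≈ _ same _ = ⊥-elim (edge⇒dist≢ x uv same)
  ... | tri> _ _ vₓ<uₓ = inj₂ (≤-antisym (edge⇒dist≤1+dist (edge-sym uv) x) vₓ<uₓ)

SameMultiset : ∀ {n} → Graph n → VSet n → Fin n → Fin n → Set
SameMultiset G S x y = ∀ r → mult G S x r ≡ mult G S y r

SameMultiset⇒sameM : ∀ {n} (G : Graph n) (S : VSet n) {x y} → SameMultiset G S x y → sameM G S x y ≡ true
SameMultiset⇒sameM {n} G S {x} {y} same = allUpTo-true n (λ r → ≡⇒≡ᵇ-true (same r))
  where
    ≡⇒≡ᵇ-true : ∀ {a b} → a ≡ b → (a ≡ᵇ b) ≡ true
    ≡⇒≡ᵇ-true {a} refl = Bool.T-≡ .Equivalence.to (≡⇒≡ᵇ a a refl)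
    allUpTo-true : ∀ m {p : ℕ → Bool} → (∀ r → p r ≡ true) → allUpTo m p ≡ true
    allUpTo-true zero    p≗true = p≗true zero
    allUpTo-true (suc m) p≗true = ∧-true⁺ (p≗true (suc m)) (allUpTo-true m p≗true)

classSize-≥2 : ∀ {n} (G : Graph n) (S : VSet n) {x} y₁ y₂ → y₁ ≢ y₂ → S y₁ ≡ false → S y₂ ≡ false →
               SameMultiset G S x y₁ → SameMultiset G S x y₂ → 2 ≤ classSize G S x
classSize-≥2 G S {x} y₁ y₂ y₁≢y₂ y₁∉S y₂∉S x~y₁ x~y₂ =
  countF-≥2 (λ y → not (S y) ∧ sameM G S x y) y₁ y₂ y₁≢y₂
    (∧-true⁺ (cong not y₁∉S) (SameMultiset⇒sameM G S x~y₁))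
    (∧-true⁺ (cong not y₂∉S) (SameMultiset⇒sameM G S x~y₂))

kappaAtLeast-intro : ∀ {n} (G : Graph n) (S : VSet n) {k} → (∃ λ s → S s ≡ true) → (∃ λ x → S x ≡ false) →
                     (∀ x → S x ≡ false → k ≤ classSize G S x) → KappaAtLeast G k
kappaAtLeast-intro G S nonempty (x₀ , x₀∉S) large
  with m , m∉S , m-min ← minimiser (λ y → S y Bool.≟ false) (classSize G S) x₀∉S =
  classSize G S m , S , large m m∉S , nonempty , (x₀ , x₀∉S) , (m , m∉S , refl) , m-min

｛_｝ : ∀ {n} → Fin n → VSet n
｛ c ｝ s = s == c

｛_｝∪｛_｝ : ∀ {n} → Fin n → Fin n → VSet n
｛ c ｝∪｛ c′ ｝ s = (s == c) ∨ (s == c′)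

∉｛｝∪｛｝ : ∀ {n} {c c′ y : Fin n} → y ≢ c → y ≢ c′ → ｛ c ｝∪｛ c′ ｝ y ≡ false
∉｛｝∪｛｝ y≢c y≢c′ rewrite ≢⇒==-false y≢c | ≢⇒==-false y≢c′ = refl

mult-｛｝ : ∀ {n} (G : Graph n) c x r → mult G ｛ c ｝ x r ≡ indicator (dist G x c ≡ᵇ r)
mult-｛｝ G c x r = countF-==∧ c (λ s → dist G x s ≡ᵇ r)

mult-｛｝∪｛｝ : ∀ {n} (G : Graph n) {c c′} → c ≢ c′ → ∀ x r →
            mult G ｛ c ｝∪｛ c′ ｝ x r ≡ indicator (dist G x c ≡ᵇ r) + indicator (dist G x c′ ≡ᵇ r)
mult-｛｝∪｛｝ G {c} {c′} c≢c′ x r = begin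
  countF (λ s → ((s == c) ∨ (s == c′)) ∧ hit s)
    ≡⟨ countF-cong (λ s → Bool.∧-distribʳ-∨ (hit s) (s == c) (s == c′)) ⟩
  countF (λ s → ((s == c) ∧ hit s) ∨ ((s == c′) ∧ hit s))
    ≡⟨ countF-∨ _ _ disjoint ⟩
  countF (λ s → (s == c) ∧ hit s) + countF (λ s → (s == c′) ∧ hit s)
    ≡⟨ cong₂ _+_ (countF-==∧ c hit) (countF-==∧ c′ hit) ⟩
  indicator (hit c) + indicator (hit c′)
    ∎
  where
    open ≡-Reasoning
    hit : Fin _ → Bool
    hit s = dist G x s ≡ᵇ r
    disjoint : ∀ s → ((s == c) ∧ hit s) ∧ ((s == c′) ∧ hit s) ≡ false
    disjoint s with s == c in s≡c | s == c′ in s≡c′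
    ... | true  | true  = ⊥-elim (c≢c′ (trans (sym (==⇒≡ {x = s} s≡c)) (==⇒≡ {x = s} s≡c′)))
    ... | true  | false = Bool.∧-zeroʳ _
    ... | false | _     = refl

module Center {n} (G : Graph n) (G-sym : ∀ x y → G x y ≡ G y x) (G-irrefl : ∀ x → G x x ≡ false)
              (connected : Connected G) (acyclic : ¬ HasCycle G) (3≤n : 3 ≤ n) where
  open Tree G G-sym G-irrefl connected acyclic

  farthest : Fin n → Fin n
  farthest x = argmax (dist G x) x (allFin n)

  eccentricity : Fin n → ℕ
  eccentricity x = dist G x (farthest x)

  dist≤eccentricity : ∀ x y → dist G x y ≤ eccentricity x
  dist≤eccentricity x y = All.lookup (f[xs]≤f[argmax] x (allFin n)) (∈-allFin y)

  central : ∃ λ c → ∀ y → eccentricity c ≤ eccentricity y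
  central = argmin eccentricity x₀ (allFin n) , λ y → All.lookup (f[argmin]≤f[xs] x₀ (allFin n)) (∈-allFin y)
    where
      x₀ : Fin n
      x₀ = fromℕ< (≤-trans (s≤s z≤n) 3≤n)

  module Centred (c : Fin n) (r≤eccentricity : ∀ y → eccentricity c ≤ eccentricity y) where
    r : ℕ
    r = eccentricity c

    depth : Fin n → ℕ
    depth = dist G c

    b : Fin n
    b = farthest c

    0<r : 0 < r
    0<r with z , z≢c , _ ← fresh 3≤n c c = ≤-trans (≢⇒0<dist z≢c) (dist≤eccentricity c z)

    -- Every vertex at least as deep as w is reached from c through w.
    unique-depth⇒closer : ∀ {w c′} → (∀ y → depth y ≡ depth w → y ≡ w) → depth w < r →
                          G c c′ ≡ true → suc (dist G c′ w) ≡ depth w → ∀ x → dist G c′ x < r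
    unique-depth⇒closer {w} {c′} w-unique dw<r cc′ 1+dist-c′-w x with ≤-<-connex (depth w) (depth x)
    ... | inj₂ dx<dw = ≤-<-trans (≤-trans (edge⇒dist≤1+dist cc′ x) dx<dw) dw<r
    ... | inj₁ dw≤dx = begin-strict
      dist G c′ x                        ≤⟨ dist-triangle c′ w x ⟩
      dist G c′ w + dist G w x           ≡⟨ cong (dist G c′ w +_) w-x ⟩
      dist G c′ w + (depth x ∸ depth w)  <⟨ +-monoˡ-< (depth x ∸ depth w) (≤-reflexive 1+dist-c′-w) ⟩
      depth w + (depth x ∸ depth w)      ≡⟨ m+[n∸m]≡n dw≤dx ⟩
      depth x                            ≤⟨ dist≤eccentricity c x ⟩
      r                                  ∎
      where
        open ≤-Reasoning
        on-level-w = geodesic-dist (geodesic c x) refl (depth w) dw≤dx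
        w-x : dist G w x ≡ depth x ∸ depth w
        w-x = subst (λ v → dist G v x ≡ depth x ∸ depth w) (w-unique _ (proj₁ on-level-w)) (proj₂ on-level-w)

    depth-not-unique : ∀ w → 0 < depth w → depth w < r → ¬ (∀ y → depth y ≡ depth w → y ≡ w)
    depth-not-unique w 0<dw dw<r w-unique = c′-more-central (first-step 0<dw)
      where
        c′-more-central : (∃ λ c′ → G c c′ ≡ true × suc (dist G c′ w) ≡ depth w) → ⊥
        c′-more-central (c′ , cc′ , 1+dist-c′-w) =
          <⇒≱ (unique-depth⇒closer w-unique dw<r cc′ 1+dist-c′-w (farthest c′)) (r≤eccentricity c′)

    another-at-depth : ∀ w → 0 < depth w → depth w < r → ∃ λ y → depth y ≡ depth w × y ≢ w
    another-at-depth w 0<dw dw<r with unique-or-another (λ y → depth y ≟ depth w) w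
    ... | inj₁ unique  = ⊥-elim (depth-not-unique w 0<dw dw<r unique)
    ... | inj₂ another = another

    module TwoDeepest (y₀ : Fin n) (dy₀≡r : depth y₀ ≡ r) (y₀≢b : y₀ ≢ b) where
      mult-depth : ∀ x t → mult G ｛ c ｝ x t ≡ indicator (depth x ≡ᵇ t)
      mult-depth x t = trans (mult-｛｝ G c x t) (cong (λ d → indicator (d ≡ᵇ t)) (dist-sym x c))

      same-depth-class≥2 : ∀ {x} y → ｛ c ｝ x ≡ false → depth y ≡ depth x → y ≢ x →
                           2 ≤ classSize G ｛ c ｝ x
      same-depth-class≥2 {x} y x∉S dy≡dx y≢x =
        classSize-≥2 G ｛ c ｝ x y (≢-sym y≢x) x∉S y∉S (λ _ → refl)
          (λ t → trans (mult-depth x t) (trans (cong (λ d → indicator (d ≡ᵇ t)) (sym dy≡dx)) (sym (mult-depth y t))))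
        where
          y∉S : ｛ c ｝ y ≡ false
          y∉S = ≢⇒==-false (0<dist⇒≢ (subst (0 <_) (sym dy≡dx) (≢⇒0<dist (==-false⇒≢ x∉S))))

      classes≥2 : ∀ x → ｛ c ｝ x ≡ false → 2 ≤ classSize G ｛ c ｝ x
      classes≥2 x x∉S with m≤n⇒m<n∨m≡n (dist≤eccentricity c x)
      ... | inj₁ dx<r with y , dy≡dx , y≢x ← another-at-depth x (≢⇒0<dist (==-false⇒≢ x∉S)) dx<r =
        same-depth-class≥2 y x∉S dy≡dx y≢x
      ... | inj₂ dx≡r with x Fin.≟ b
      ...   | yes refl = same-depth-class≥2 y₀ x∉S dy₀≡r y₀≢b
      ...   | no  x≢b  = same-depth-class≥2 b x∉S (sym dx≡r) (≢-sym x≢b)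

      kappa≥2 : KappaAtLeast G 2
      kappa≥2 with z , z≢c , _ ← fresh 3≤n c c =
        kappaAtLeast-intro G ｛ c ｝ (c , ==-refl c) (z , ≢⇒==-false z≢c) classes≥2

    module SoleDeepest (b-unique : ∀ y → depth y ≡ r → y ≡ b)
                       (c′ : Fin n) (cc′ : G c c′ ≡ true) (1+dist-c′-b : suc (dist G c′ b) ≡ r) where

      β : Fin n → ℕ
      β = dist G c′

      β≤r : ∀ y → β y ≤ r
      β≤r y = [_,_]′ (λ dy<r → ≤-trans (edge⇒dist≤1+dist cc′ y) dy<r)
                (λ dy≡r → subst (λ z → β z ≤ r) (sym (b-unique y dy≡r)) (<⇒≤ (≤-reflexive 1+dist-c′-b)))
                (m≤n⇒m<n∨m≡n (dist≤eccentricity c y))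

      xs : Fin n
      xs = farthest c′

      βxs≡r : β xs ≡ r
      βxs≡r = ≤-antisym (β≤r xs) (r≤eccentricity c′)

      1+dxs≡r : suc (depth xs) ≡ r
      1+dxs≡r = ≤-antisym dxs<r (subst (_≤ suc (depth xs)) βxs≡r (edge⇒dist≤1+dist cc′ xs))
        where
          dxs<r : depth xs < r
          dxs<r = ≤∧≢⇒< (dist≤eccentricity c xs)
                    (λ dxs≡r → 1+n≢n (trans 1+dist-c′-b (trans (sym βxs≡r) (cong β (b-unique xs dxs≡r)))))

      -- p runs from c away from c′ and q from c′ away from c, so p i and q i both have distances
      -- i and i + 1 to c and c′, in opposite orders.
      p q : ℕ → Fin n
      p i = geodesic c xs [ i ]
      q i = geodesic c′ b [ i ]

      p-depths : ∀ {i} → i < r → depth (p i) ≡ i × β (p i) ≡ suc i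
      p-depths i<r = geodesic-away cc′ (trans βxs≡r (sym 1+dxs≡r)) (≤-pred (subst (_ <_) (sym 1+dxs≡r) i<r))

      q-depths : ∀ {i} → i < r → β (q i) ≡ i × depth (q i) ≡ suc i
      q-depths i<r = geodesic-away (edge-sym cc′) (sym 1+dist-c′-b) (≤-pred (subst (_ <_) (sym 1+dist-c′-b) i<r))

      S : VSet n
      S = ｛ c ｝∪｛ c′ ｝

      Straddles : ℕ → Fin n → Set
      Straddles i x = (depth x ≡ i × β x ≡ suc i) ⊎ (β x ≡ i × depth x ≡ suc i)

      mult-S : ∀ x t → mult G S x t ≡ indicator (depth x ≡ᵇ t) + indicator (β x ≡ᵇ t)
      mult-S x t = trans (mult-｛｝∪｛｝ G (edge⇒≢ cc′) x t)
        (cong₂ (λ d e → indicator (d ≡ᵇ t) + indicator (e ≡ᵇ t)) (dist-sym x c) (dist-sym x c′))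

      mult-Straddles : ∀ {i x} → Straddles i x → ∀ t →
                       mult G S x t ≡ indicator (i ≡ᵇ t) + indicator (suc i ≡ᵇ t)
      mult-Straddles {x = x} (inj₁ (dx≡i , βx≡1+i)) t =
        trans (mult-S x t) (cong₂ (λ d e → indicator (d ≡ᵇ t) + indicator (e ≡ᵇ t)) dx≡i βx≡1+i)
      mult-Straddles {i} {x} (inj₂ (βx≡i , dx≡1+i)) t =
        trans (mult-S x t) (trans (cong₂ (λ d e → indicator (d ≡ᵇ t) + indicator (e ≡ᵇ t)) dx≡1+i βx≡i)
                                  (+-comm (indicator (suc i ≡ᵇ t)) (indicator (i ≡ᵇ t))))

      ∉S : ∀ {y} → 0 < depth y → 0 < β y → S y ≡ false
      ∉S 0<dy 0<βy = ∉｛｝∪｛｝ (0<dist⇒≢ 0<dy) (0<dist⇒≢ 0<βy)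

      Straddles⇒∉S : ∀ {i y} → 0 < i → Straddles i y → S y ≡ false
      Straddles⇒∉S 0<i (inj₁ (dy≡i , βy≡1+i)) =
        ∉S (subst (0 <_) (sym dy≡i) 0<i) (subst (0 <_) (sym βy≡1+i) (s≤s z≤n))
      Straddles⇒∉S 0<i (inj₂ (βy≡i , dy≡1+i)) =
        ∉S (subst (0 <_) (sym dy≡1+i) (s≤s z≤n)) (subst (0 <_) (sym βy≡i) 0<i)

      straddling-class≥2 : ∀ {i x} → 0 < i → i < r → Straddles i x → 2 ≤ classSize G S x
      straddling-class≥2 {i} {x} 0<i i<r x-straddles =
        classSize-≥2 G S (p i) (q i) p≢q (Straddles⇒∉S 0<i p-straddles) (Straddles⇒∉S 0<i q-straddles)
          (λ t → trans (mult-Straddles x-straddles t) (sym (mult-Straddles p-straddles t)))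
          (λ t → trans (mult-Straddles x-straddles t) (sym (mult-Straddles q-straddles t)))
        where
          p-straddles : Straddles i (p i)
          p-straddles = inj₁ (p-depths i<r)
          q-straddles : Straddles i (q i)
          q-straddles = inj₂ (q-depths i<r)
          p≢q : p i ≢ q i
          p≢q pᵢ≡qᵢ = 1+n≢n (begin
            suc i         ≡⟨ proj₂ (q-depths i<r) ⟨
            depth (q i)   ≡⟨ cong depth pᵢ≡qᵢ ⟨
            depth (p i)   ≡⟨ proj₁ (p-depths i<r) ⟩
            i             ∎)
            where open ≡-Reasoning

      classes≥2 : ∀ x → S x ≡ false → 2 ≤ classSize G S x
      classes≥2 x x∉S = [ below-β , below-depth ]′ (edge⇒dist-step x cc′)
        where
          x≢c : x ≢ c
          x≢c = ==-false⇒≢ (proj₁ (∨-false⁻ {x == c} x∉S))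
          x≢c′ : x ≢ c′
          x≢c′ = ==-false⇒≢ (proj₂ (∨-false⁻ {x == c} x∉S))
          below-β : β x ≡ suc (depth x) → 2 ≤ classSize G S x
          below-β βx≡1+dx =
            straddling-class≥2 (≢⇒0<dist x≢c) (subst (_≤ r) βx≡1+dx (β≤r x)) (inj₁ (refl , βx≡1+dx))
          below-depth : depth x ≡ suc (β x) → 2 ≤ classSize G S x
          below-depth dx≡1+βx =
            straddling-class≥2 (≢⇒0<dist x≢c′) (subst (_≤ r) dx≡1+βx (dist≤eccentricity c x))
              (inj₂ (refl , dx≡1+βx))

      kappa≥2 : KappaAtLeast G 2
      kappa≥2 with z , z≢c , z≢c′ ← fresh 3≤n c c′ =
        kappaAtLeast-intro G S (c , cong (_∨ (c == c′)) (==-refl c)) (z , ∉｛｝∪｛｝ z≢c z≢c′) classes≥2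

    kappa≥2 : KappaAtLeast G 2
    kappa≥2 = [ sole-deepest , two-deepest ]′ (unique-or-another (λ y → depth y ≟ r) b)
      where
        two-deepest : (∃ λ y₀ → depth y₀ ≡ r × y₀ ≢ b) → KappaAtLeast G 2
        two-deepest (y₀ , dy₀≡r , y₀≢b) = TwoDeepest.kappa≥2 y₀ dy₀≡r y₀≢b
        sole-deepest : (∀ y → depth y ≡ r → y ≡ b) → KappaAtLeast G 2
        sole-deepest b-unique = towards-b (first-step 0<r)
          where
            towards-b : (∃ λ c′ → G c c′ ≡ true × suc (dist G c′ b) ≡ r) → KappaAtLeast G 2
            towards-b (c′ , cc′ , 1+dist-c′-b) = SoleDeepest.kappa≥2 b-unique c′ cc′ 1+dist-c′-b

theorem6 : ∀ (n : ℕ) (T : Graph n) → IsTree T → 3 ≤ n → KappaAtLeast T 2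
theorem6 n T ((T-sym , T-irrefl) , connected , acyclic) 3≤n =
  Centred.kappa≥2 (proj₁ central) (proj₂ central)
  where open Center T T-sym T-irrefl connected acyclic 3≤n
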